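{- Let $E$ be a disjoint combination of AC convergent theories $E_1,\ldots,E_n$ and fix $i$. If $M$ is a (ground) quasi-$E_i$ term and $M\to^*_{R_E}N$, then $N$ is a quasi-$E_i$ term and $F_{E_i}(M)\to^*_{R_E}F_{E_i}(N)$.
   Context: Terms are built from names, variables, constructors (symbols such as pairing, encryption, signing, disjoint from all $\Sigma_{E_i}$), and function symbols of pairwise disjoint signatures $\Sigma_{E_1},\ldots,\Sigma_{E_n}$. $E$ is the union of equational theories $E_1,\ldots,E_n$, $E_i$ over $\Sigma_{E_i}$ containing at most one associative-commutative (AC) symbol $\oplus_i$; $E$ is presented by a rewrite system $R_E$ (every variable of a rule's right-hand side occurs in its left-hand side) that is terminating and confluent modulo AC. $\to_{R_E}$ is one-step rewriting modulo AC and $\to^*_{R_E}$ its reflexive-transitive closure; $\approx_E$ is equality modulo $E$. A term is $E_i$-alien if it is headed by a symbol not in $\Sigma_{E_i}$. $M$ is a quasi-$E_i$ term if every $E_i$-alien subterm of $M$ is in $E$-normal form. Fix a function $v_E$ assigning to each ground term a variable such that $v_E(M)=v_E(N)$ iff $M\approx_E N$. The $E_i$ abstraction function on ground terms: $F_{E_i}(u)=u$ if $u$ is a name; $F_{E_i}(f(u_1,\ldots,u_k))=f(F_{E_i}(u_1),\ldots,F_{E_i}(u_k))$ if $f\in\Sigma_{E_i}$; $F_{E_i}(u)=v_E(u)$ otherwise. -}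

module Defs where

open import Data.Nat using (ℕ)
open import Data.Fin using (Fin; _≟_)
open import Data.Vec using (Vec; []; _∷_; _[_]≔_)
open import Data.Maybe using (Maybe; just)
open import Data.Product using (Σ; ∃; _×_; _,_)
open import Data.Sum using (_⊎_)
open import Relation.Nullary using (¬_; yes; no)
open import Relation.Binary.PropositionalEquality using (_≡_; _≢_; refl; subst; sym)
open import Relation.Binary.Construct.Closure.ReflexiveTransitive using (Star)
open import Relation.Binary.Construct.Closure.Equivalence using (EqClosure)
open import Induction.WellFounded using (WellFounded)
open import Function using (flip)
open import Function.Bundles using (_⇔_)

-- A signature: n theories with pairwise disjoint signatures Sym i (disjoint by
-- construction, being indexed by i), constructors Con, names Name, variables Var.
record Sig : Set₁ where
  field
    n     : ℕ
    Name  : Set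
    Var   : Set
    Con   : Set
    conAr : Con → ℕ
    Sym   : Fin n → Set
    ar    : ∀ {i} → Sym i → ℕ
    acSym : (i : Fin n) → Maybe (Σ (Sym i) λ f → ar f ≡ 2)

module Terms (S : Sig) where
  open Sig S

  data Term : Set where
    nm  : Name → Term
    var : Var → Term
    con : (c : Con) → Vec Term (conAr c) → Term
    fn  : (i : Fin n) (f : Sym i) → Vec Term (ar f) → Term

  data Ctx : Set where
    □    : Ctx
    conC : (c : Con) → Fin (conAr c) → Vec Term (conAr c) → Ctx → Ctx
    fnC  : (i : Fin n) (f : Sym i) → Fin (ar f) → Vec Term (ar f) → Ctx → Ctx

  plug : Ctx → Term → Term
  plug □ t = t
  plug (conC c k ts C) t = con c (ts [ k ]≔ plug C t)
  plug (fnC i f k ts C) t = fn i f (ts [ k ]≔ plug C t)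

  _⊴_ : Term → Term → Set
  s ⊴ t = ∃ λ C → plug C s ≡ t

  Ground : Term → Set
  Ground t = ∀ x → ¬ (var x ⊴ t)

  mutual
    _⟨_⟩ : Term → (Var → Term) → Term
    nm a ⟨ σ ⟩ = nm a
    var x ⟨ σ ⟩ = σ x
    con c ts ⟨ σ ⟩ = con c (ts ⟨ σ ⟩*)
    fn i f ts ⟨ σ ⟩ = fn i f (ts ⟨ σ ⟩*)

    _⟨_⟩* : ∀ {k} → Vec Term k → (Var → Term) → Vec Term k
    [] ⟨ σ ⟩* = []
    (t ∷ ts) ⟨ σ ⟩* = (t ⟨ σ ⟩) ∷ (ts ⟨ σ ⟩*)

  bin : (i : Fin n) (f : Sym i) → ar f ≡ 2 → Term → Term → Term
  bin i f p x y = fn i f (subst (Vec Term) (sym p) (x ∷ y ∷ []))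

  data ACax : Term → Term → Set where
    comm  : ∀ {i f p} x y → acSym i ≡ just (f , p) →
            ACax (bin i f p x y) (bin i f p y x)
    assoc : ∀ {i f p} x y z → acSym i ≡ just (f , p) →
            ACax (bin i f p (bin i f p x y) z) (bin i f p x (bin i f p y z))

  ACstep : Term → Term → Set
  ACstep s t = ∃ λ C → ∃ λ u → ∃ λ w → ACax u w × s ≡ plug C u × t ≡ plug C w

  _=AC_ : Term → Term → Set
  _=AC_ = EqClosure ACstep

  data Alien (i : Fin n) : Term → Set where
    conA : ∀ c ts → Alien i (con c ts)
    fnA  : ∀ j (f : Sym j) ts → j ≢ i → Alien i (fn j f ts)

  data Foreign (i : Fin n) : Term → Set where
    nmF  : ∀ a → Foreign i (nm a)
    alF  : ∀ {t} → Alien i t → Foreign i t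

  Pure : Fin n → Term → Set
  Pure i t = ∀ s → s ⊴ t → ¬ Foreign i s

  record Rule : Set where
    constructor _⇒_
    field
      lhs rhs : Term
  open Rule public

module Rewriting (S : Sig) (R : Fin (Sig.n S) → Terms.Rule S → Set) where
  open Sig S
  open Terms S

  Rstep : Term → Term → Set
  Rstep s t = ∃ λ i → ∃ λ ρ → R i ρ × ∃ λ C → ∃ λ (σ : Var → Term) →
              s ≡ plug C (lhs ρ ⟨ σ ⟩) × t ≡ plug C (rhs ρ ⟨ σ ⟩)

  _⟶_ : Term → Term → Set
  s ⟶ t = ∃ λ s' → ∃ λ t' → s =AC s' × Rstep s' t' × t' =AC t

  _⟶*_ : Term → Term → Set
  _⟶*_ = Star _⟶_

  _≈E_ : Term → Term → Set
  _≈E_ = EqClosure (λ s t → Rstep s t ⊎ ACstep s t)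

  NormalForm : Term → Set
  NormalForm t = ¬ (∃ λ u → t ⟶ u)

  Quasi : Fin n → Term → Set
  Quasi i t = ∀ s → s ⊴ t → Alien i s → NormalForm s

  Terminating : Set
  Terminating = WellFounded (flip _⟶_)

  ConfluentModAC : Set
  ConfluentModAC = ∀ M N₁ N₂ → M ⟶* N₁ → M ⟶* N₂ →
    ∃ λ P₁ → ∃ λ P₂ → N₁ ⟶* P₁ × N₂ ⟶* P₂ × P₁ =AC P₂

  WellFormedRules : Set
  WellFormedRules = ∀ i ρ → R i ρ →
    Pure i (lhs ρ) × Pure i (rhs ρ) × (∀ x → var x ⊴ rhs ρ → var x ⊴ lhs ρ)

  IsVE : (Term → Var) → Set
  IsVE v = ∀ M N → Ground M → Ground N → (v M ≡ v N) ⇔ (M ≈E N)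

  module Abstraction (v : Term → Var) (i : Fin n) where
    mutual
      F : Term → Term
      F (nm a) = nm a
      F (var x) = var (v (var x))   -- not reached on ground terms
      F (con c ts) = var (v (con c ts))
      F (fn j f ts) with j ≟ i
      ... | yes refl = fn j f (F* ts)
      ... | no _ = var (v (fn j f ts))

      F* : ∀ {k} → Vec Term k → Vec Term k
      F* [] = []
      F* (t ∷ ts) = F t ∷ F* ts

module Submission where

open import Defs
open import Data.Fin using (Fin; zero; suc; _≟_)
open import Data.Vec using (Vec; []; _∷_; _[_]≔_; lookup)
open import Data.Vec.Properties using ([]≔-lookup; lookup∘update)
open import Data.Vec.Relation.Unary.All using (All; []; _∷_)
open import Data.Vec.Relation.Unary.All.Properties using (lookup⁺)
open import Data.Product using (_×_; _,_; proj₁; proj₂)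
open import Data.Sum using (inj₂)
open import Data.Empty using (⊥; ⊥-elim)
open import Relation.Nullary using (yes; no)
open import Relation.Binary.PropositionalEquality
open import Relation.Binary.Construct.Closure.ReflexiveTransitive using (Star; ε; _◅_; _◅◅_)
import Relation.Binary.Construct.Closure.ReflexiveTransitive.Properties as Star
open import Relation.Binary.Construct.Closure.Symmetric using (SymClosure; fwd; bwd)
import Relation.Binary.Construct.Closure.Symmetric as SymClosure
import Relation.Binary.Construct.Closure.Equivalence as EqClosure
open import Induction.WellFounded using (Acc; acc)
open import Function using (_∘_)
open import Function.Bundles using (Equivalence)

-- It suffices to treat single AC moves and single plain rule steps, carrying the
-- invariant "ground and quasi-E_i" (lemma simulate*).  A quasi-E_i term consists of an
-- upper E_i-layer (names, variables, Σ_{E_i}-symbols) whose leaves are alien normal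
-- forms.  The position of a step (lemma classify) either lies inside the layer, where F
-- commutes with the context and the step is mapped to the same step on F-images, or
-- inside an alien leaf.  A rule step cannot occur inside a normal form; an AC move
-- there leaves an AC-equal, hence E-equal, alien normal form, which v_E abstracts by
-- the same variable.  Rule steps within the layer use rules of E_i only: the
-- left-hand side is a Σ_{E_i}-term (not a variable, by termination), and F commutes
-- with instantiating pure terms.

simulate* : {A B : Set} {P : A → Set} {T : A → A → Set} {U : B → B → Set}
  (f : A → B) → (∀ {s t} → T s t → P s → P t × Star U (f s) (f t)) →
  ∀ {s t} → Star T s t → P s → P t × Star U (f s) (f t)
simulate* f sim ε p = p , ε
simulate* f sim (st ◅ sts) p =
  let p₁ , us₁ = sim st p
      p₂ , us₂ = simulate* f sim sts p₁
  in p₂ , us₁ ◅◅ us₂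

module _ {A : Set} {P : A → Set} where

  All-at-update : ∀ {m} (xs : Vec A m) k {x} → All P (xs [ k ]≔ x) → P x
  All-at-update xs k {x} ps = subst P (lookup∘update k xs x) (lookup⁺ ps k)

  All-update : ∀ {m} (xs : Vec A m) k {x y} → All P (xs [ k ]≔ x) → P y →
    All P (xs [ k ]≔ y)
  All-update (x ∷ xs) zero (p ∷ ps) q = q ∷ ps
  All-update (x ∷ xs) (suc k) (p ∷ ps) q = p ∷ All-update xs k ps q

  All-subst : ∀ {a b} (q : a ≡ b) {xs : Vec A a} → All P xs → All P (subst (Vec A) q xs)
  All-subst refl ps = ps

  All-subst⁻ : ∀ {a b} (q : a ≡ b) {xs : Vec A a} → All P (subst (Vec A) q xs) → All P xs
  All-subst⁻ refl ps = ps

module TermFacts (S : Sig) where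
  open Sig S
  open Terms S

  _·_ : Ctx → Ctx → Ctx
  □ · D = D
  conC c k ts C · D = conC c k ts (C · D)
  fnC j f k ts C · D = fnC j f k ts (C · D)

  plug-· : ∀ C D t → plug (C · D) t ≡ plug C (plug D t)
  plug-· □ D t = refl
  plug-· (conC c k ts C) D t = cong (λ x → con c (ts [ k ]≔ x)) (plug-· C D t)
  plug-· (fnC j f k ts C) D t = cong (λ x → fn j f (ts [ k ]≔ x)) (plug-· C D t)

  ⊴-refl : ∀ {t} → t ⊴ t
  ⊴-refl = □ , refl

  ⊴-trans : ∀ {s u t} → s ⊴ u → u ⊴ t → s ⊴ t
  ⊴-trans (C , refl) (D , refl) = D · C , plug-· D C _

  ⊴-fn : ∀ j f ts k → lookup ts k ⊴ fn j f ts
  ⊴-fn j f ts k = fnC j f k ts □ , cong (fn j f) ([]≔-lookup ts k)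

  ⊴-con : ∀ c ts k → lookup ts k ⊴ con c ts
  ⊴-con c ts k = conC c k ts □ , cong (con c) ([]≔-lookup ts k)

  _⟨_⟩ᶜ : Ctx → (Var → Term) → Ctx
  □ ⟨ σ ⟩ᶜ = □
  conC c k ts C ⟨ σ ⟩ᶜ = conC c k (ts ⟨ σ ⟩*) (C ⟨ σ ⟩ᶜ)
  fnC j f k ts C ⟨ σ ⟩ᶜ = fnC j f k (ts ⟨ σ ⟩*) (C ⟨ σ ⟩ᶜ)

  update-subst : ∀ {m} (ts : Vec Term m) k x σ →
    (ts [ k ]≔ x) ⟨ σ ⟩* ≡ (ts ⟨ σ ⟩*) [ k ]≔ (x ⟨ σ ⟩)
  update-subst (t ∷ ts) zero x σ = refl
  update-subst (t ∷ ts) (suc k) x σ = cong ((t ⟨ σ ⟩) ∷_) (update-subst ts k x σ)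

  plug-subst : ∀ C t σ → (plug C t) ⟨ σ ⟩ ≡ plug (C ⟨ σ ⟩ᶜ) (t ⟨ σ ⟩)
  plug-subst □ t σ = refl
  plug-subst (conC c k ts C) t σ =
    cong (con c) (trans (update-subst ts k _ σ) (cong (_ [ k ]≔_) (plug-subst C t σ)))
  plug-subst (fnC j f k ts C) t σ =
    cong (fn j f) (trans (update-subst ts k _ σ) (cong (_ [ k ]≔_) (plug-subst C t σ)))

  var-⊴-subst : ∀ {x t} σ → var x ⊴ t → σ x ⊴ (t ⟨ σ ⟩)
  var-⊴-subst σ (C , refl) = C ⟨ σ ⟩ᶜ , sym (plug-subst C _ σ)

  data IsGround : Term → Set where
    nmG  : ∀ a → IsGround (nm a)
    conG : ∀ c {ts} → All IsGround ts → IsGround (con c ts)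
    fnG  : ∀ j f {ts} → All IsGround ts → IsGround (fn j f ts)

  mutual
    ground⇒ : ∀ t → Ground t → IsGround t
    ground⇒ (nm a) g = nmG a
    ground⇒ (var x) g = ⊥-elim (g x ⊴-refl)
    ground⇒ (con c ts) g = conG c (ground⇒* ts (λ k x o → g x (⊴-trans o (⊴-con c ts k))))
    ground⇒ (fn j f ts) g = fnG j f (ground⇒* ts (λ k x o → g x (⊴-trans o (⊴-fn j f ts k))))

    ground⇒* : ∀ {m} (ts : Vec Term m) → (∀ k → Ground (lookup ts k)) → All IsGround ts
    ground⇒* [] g = []
    ground⇒* (t ∷ ts) g = ground⇒ t (g zero) ∷ ground⇒* ts (g ∘ suc)

  ground-plug⁻ : ∀ C {u} → IsGround (plug C u) → IsGround u
  ground-plug⁻ □ g = g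
  ground-plug⁻ (conC c k ts C) (conG _ gs) = ground-plug⁻ C (All-at-update ts k gs)
  ground-plug⁻ (fnC j f k ts C) (fnG _ _ gs) = ground-plug⁻ C (All-at-update ts k gs)

  ground-replace : ∀ C {u w} → IsGround (plug C u) → IsGround w → IsGround (plug C w)
  ground-replace □ g h = h
  ground-replace (conC c k ts C) (conG _ gs) h =
    conG c (All-update ts k gs (ground-replace C (All-at-update ts k gs) h))
  ground-replace (fnC j f k ts C) (fnG _ _ gs) h =
    fnG j f (All-update ts k gs (ground-replace C (All-at-update ts k gs) h))

  ground-⊴ : ∀ {s t} → s ⊴ t → IsGround t → IsGround s
  ground-⊴ (C , refl) = ground-plug⁻ C

  ⇐ground : ∀ {t} → IsGround t → Ground t
  ⇐ground g x (C , refl) with ground-plug⁻ C g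
  ... | ()

  mutual
    ground-subst : ∀ t σ → (∀ x → var x ⊴ t → IsGround (σ x)) → IsGround (t ⟨ σ ⟩)
    ground-subst (nm a) σ h = nmG a
    ground-subst (var x) σ h = h x ⊴-refl
    ground-subst (con c ts) σ h =
      conG c (ground-subst* ts σ (λ k x o → h x (⊴-trans o (⊴-con c ts k))))
    ground-subst (fn j f ts) σ h =
      fnG j f (ground-subst* ts σ (λ k x o → h x (⊴-trans o (⊴-fn j f ts k))))

    ground-subst* : ∀ {m} (ts : Vec Term m) σ →
      (∀ k x → var x ⊴ lookup ts k → IsGround (σ x)) → All IsGround (ts ⟨ σ ⟩*)
    ground-subst* [] σ h = []
    ground-subst* (t ∷ ts) σ h = ground-subst t σ (h zero) ∷ ground-subst* ts σ (h ∘ suc)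

  ground-bin⁻ : ∀ {j} f p x y → IsGround (bin j f p x y) → IsGround x × IsGround y
  ground-bin⁻ f p x y (fnG _ _ gs) with All-subst⁻ (sym p) gs
  ... | gx ∷ gy ∷ [] = gx , gy

  ground-bin : ∀ {j} f p {x y} → IsGround x → IsGround y → IsGround (bin j f p x y)
  ground-bin f p gx gy = fnG _ f (All-subst (sym p) (gx ∷ gy ∷ []))

  ACax-ground : ∀ {u w} → ACax u w → IsGround u → IsGround w
  ACax-ground (comm {f = f} {p} x y e) g =
    let gx , gy = ground-bin⁻ f p x y g in ground-bin f p gy gx
  ACax-ground (assoc {f = f} {p} x y z e) g =
    let gxy , gz = ground-bin⁻ f p _ z g ; gx , gy = ground-bin⁻ f p x y gxy
    in ground-bin f p gx (ground-bin f p gy gz)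

  ACax-ground⁻ : ∀ {u w} → ACax u w → IsGround w → IsGround u
  ACax-ground⁻ (comm {f = f} {p} x y e) g =
    let gy , gx = ground-bin⁻ f p y x g in ground-bin f p gx gy
  ACax-ground⁻ (assoc {f = f} {p} x y z e) g =
    let gx , gyz = ground-bin⁻ f p x _ g ; gy , gz = ground-bin⁻ f p y z gyz
    in ground-bin f p (ground-bin f p gx gy) gz

module RewriteFacts (S : Sig) (R : Fin (Sig.n S) → Terms.Rule S → Set) where
  open Sig S
  open Terms S
  open Rewriting S R
  open TermFacts S

  ACmove : Term → Term → Set
  ACmove = SymClosure ACstep

  ACmove-at : ∀ C {u w} → SymClosure ACax u w → ACmove (plug C u) (plug C w)
  ACmove-at C = SymClosure.gmap (plug C) (λ ax → C , _ , _ , ax , refl , refl)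

  Rstep-ctx : ∀ D {a b} → Rstep a b → Rstep (plug D a) (plug D b)
  Rstep-ctx D (j , ρ , r , C , σ , refl , refl) =
    j , ρ , r , D · C , σ , sym (plug-· D C _) , sym (plug-· D C _)

  ACstep-ctx : ∀ D {a b} → ACstep a b → ACstep (plug D a) (plug D b)
  ACstep-ctx D (C , u , w , ax , refl , refl) =
    D · C , u , w , ax , sym (plug-· D C u) , sym (plug-· D C w)

  =AC-ctx : ∀ D {a b} → a =AC b → plug D a =AC plug D b
  =AC-ctx D = EqClosure.gmap (plug D) (ACstep-ctx D)

  ⟶-ctx : ∀ D {a b} → a ⟶ b → plug D a ⟶ plug D b
  ⟶-ctx D (a' , b' , p , st , q) =
    plug D a' , plug D b' , =AC-ctx D p , Rstep-ctx D st , =AC-ctx D q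

  Rstep⇒⟶ : ∀ {a b} → Rstep a b → a ⟶ b
  Rstep⇒⟶ st = _ , _ , ε , st , ε

  =AC⇒≈E : ∀ {a b} → a =AC b → a ≈E b
  =AC⇒≈E = EqClosure.map inj₂

  NF-plug⁻ : ∀ D {a} → NormalForm (plug D a) → NormalForm a
  NF-plug⁻ D nf (z , st) = nf (plug D z , ⟶-ctx D st)

  NF-=AC : ∀ {a a'} → NormalForm a → a =AC a' → NormalForm a'
  NF-=AC nf p (z , a'' , z' , p' , st , q) = nf (z , a'' , z' , p ◅◅ p' , st , q)

  -- A terminating system has no rule whose left-hand side is a variable: such a
  -- rule would rewrite every term.
  no-variable-lhs : Terminating → ∀ {j x r} → R j (var x ⇒ r) → ⊥
  no-variable-lhs wf {j} {x} {r} ρ = diverge _ (wf (var x))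
    where
    diverge : ∀ t → Acc (λ a b → b ⟶ a) t → ⊥
    diverge t (acc rs) =
      diverge _ (rs (Rstep⇒⟶ (j , (var x ⇒ r) , ρ , □ , (λ _ → t) , refl , refl)))

  -- Groundness is preserved by AC moves and, since right-hand side variables occur
  -- on the left, by rule steps.
  ACmove-ground : ∀ {s t} → ACmove s t → IsGround s → IsGround t
  ACmove-ground (fwd (C , u , w , ax , refl , refl)) g =
    ground-replace C g (ACax-ground ax (ground-plug⁻ C g))
  ACmove-ground (bwd (C , u , w , ax , refl , refl)) g =
    ground-replace C g (ACax-ground⁻ ax (ground-plug⁻ C g))

  Rstep-ground : WellFormedRules → ∀ {s t} → Rstep s t → IsGround s → IsGround t
  Rstep-ground wfr (j , (l ⇒ r) , ρ , C , σ , refl , refl) g =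
    ground-replace C g (ground-subst r σ ground-σ)
    where
    ground-σ : ∀ x → var x ⊴ r → IsGround (σ x)
    ground-σ x o = ground-⊴ (var-⊴-subst σ (proj₂ (proj₂ (wfr j _ ρ)) x o)) (ground-plug⁻ C g)

  ACax-alien : ∀ {i u w} → ACax u w → Alien i u → Alien i w
  ACax-alien (comm x y e) (fnA _ _ _ ne) = fnA _ _ _ ne
  ACax-alien (assoc x y z e) (fnA _ _ _ ne) = fnA _ _ _ ne

  ACax-alien⁻ : ∀ {i u w} → ACax u w → Alien i w → Alien i u
  ACax-alien⁻ (comm x y e) (fnA _ _ _ ne) = fnA _ _ _ ne
  ACax-alien⁻ (assoc x y z e) (fnA _ _ _ ne) = fnA _ _ _ ne

  plug-alien : ∀ {i} C {u w} → (Alien i u → Alien i w) → Alien i (plug C u) → Alien i (plug C w)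
  plug-alien □ h al = h al
  plug-alien (conC c k ts C) h (conA _ _) = conA _ _
  plug-alien (fnC j f k ts C) h (fnA _ _ _ ne) = fnA _ _ _ ne

  ACmove-alien : ∀ {i a a'} → ACmove a a' → Alien i a → Alien i a'
  ACmove-alien (fwd (C , _ , _ , ax , refl , refl)) = plug-alien C (ACax-alien ax)
  ACmove-alien (bwd (C , _ , _ , ax , refl , refl)) = plug-alien C (ACax-alien⁻ ax)

module Layers (S : Sig) (R : Fin (Sig.n S) → Terms.Rule S → Set)
  (term : Rewriting.Terminating S R) (wfr : Rewriting.WellFormedRules S R)
  (v : Terms.Term S → Sig.Var S) (isv : Rewriting.IsVE S R v) (i : Fin (Sig.n S)) where
  open Sig S
  open Terms S
  open Rewriting S R
  open Abstraction v i
  open TermFacts S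
  open RewriteFacts S R

  data IsQuasi : Term → Set where
    nmQ    : ∀ a → IsQuasi (nm a)
    varQ   : ∀ x → IsQuasi (var x)
    alienQ : ∀ {t} → Alien i t → NormalForm t → IsQuasi t
    fnQ    : ∀ f {ts} → All IsQuasi ts → IsQuasi (fn i f ts)

  data NonAlien : Term → Set where
    nmN  : ∀ a → NonAlien (nm a)
    varN : ∀ x → NonAlien (var x)
    fnN  : ∀ f ts → NonAlien (fn i f ts)

  data IsPure : Term → Set where
    varP : ∀ x → IsPure (var x)
    fnP  : ∀ f {ts} → All IsPure ts → IsPure (fn i f ts)

  data Layer : Ctx → Set where
    □L  : Layer □
    fnL : ∀ f k ts {C} → Layer C → Layer (fnC i f k ts C)

  fn-not-alien : ∀ {f ts} → Alien i (fn i f ts) → ⊥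
  fn-not-alien (fnA _ _ _ ne) = ne refl

  quasi-alien-NF : ∀ C {s} → IsQuasi (plug C s) → Alien i s → NormalForm s
  quasi-alien-NF □ (nmQ a) ()
  quasi-alien-NF □ (varQ x) ()
  quasi-alien-NF □ (alienQ _ nf) al = nf
  quasi-alien-NF □ (fnQ f _) al = ⊥-elim (fn-not-alien al)
  quasi-alien-NF C@(conC _ _ _ _) (alienQ _ nf) al = NF-plug⁻ C nf
  quasi-alien-NF C@(fnC _ _ _ _ _) (alienQ _ nf) al = NF-plug⁻ C nf
  quasi-alien-NF (fnC _ f k ts C) (fnQ _ qs) al = quasi-alien-NF C (All-at-update ts k qs) al

  quasi⇐ : ∀ {t} → IsQuasi t → Quasi i t
  quasi⇐ q s (C , refl) = quasi-alien-NF C q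

  quasi-⊴ : ∀ {s t} → s ⊴ t → Quasi i t → Quasi i s
  quasi-⊴ o q s' o' = q s' (⊴-trans o' o)

  mutual
    quasi⇒ : ∀ t → Quasi i t → IsQuasi t
    quasi⇒ (nm a) q = nmQ a
    quasi⇒ (var x) q = varQ x
    quasi⇒ (con c ts) q = alienQ (conA c ts) (q _ ⊴-refl (conA c ts))
    quasi⇒ (fn j f ts) q with j ≟ i
    ... | yes refl = fnQ f (quasi⇒* ts (λ k → quasi-⊴ (⊴-fn _ f ts k) q))
    ... | no ne = alienQ (fnA j f ts ne) (q _ ⊴-refl (fnA j f ts ne))

    quasi⇒* : ∀ {m} (ts : Vec Term m) → (∀ k → Quasi i (lookup ts k)) → All IsQuasi ts
    quasi⇒* [] q = []
    quasi⇒* (t ∷ ts) q = quasi⇒ t (q zero) ∷ quasi⇒* ts (q ∘ suc)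

  IsQuasi-⊴ : ∀ {s t} → s ⊴ t → IsQuasi t → IsQuasi s
  IsQuasi-⊴ {s} o q = quasi⇒ s (quasi-⊴ o (quasi⇐ q))

  mutual
    pure⇒ : ∀ t → Pure i t → IsPure t
    pure⇒ (nm a) p = ⊥-elim (p _ ⊴-refl (nmF a))
    pure⇒ (var x) p = varP x
    pure⇒ (con c ts) p = ⊥-elim (p _ ⊴-refl (alF (conA c ts)))
    pure⇒ (fn j f ts) p with j ≟ i
    ... | yes refl = fnP f (pure⇒* ts (λ k s o → p s (⊴-trans o (⊴-fn _ f ts k))))
    ... | no ne = ⊥-elim (p _ ⊴-refl (alF (fnA j f ts ne)))

    pure⇒* : ∀ {m} (ts : Vec Term m) → (∀ k → Pure i (lookup ts k)) → All IsPure ts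
    pure⇒* [] p = []
    pure⇒* (t ∷ ts) p = pure⇒ t (p zero) ∷ pure⇒* ts (p ∘ suc)

  data Position (C : Ctx) (u : Term) : Set where
    inLayer    : Layer C → NonAlien u → IsQuasi u → Position C u
    underAlien : ∀ C₁ C₂ → C ≡ C₁ · C₂ → Layer C₁ →
                 Alien i (plug C₂ u) → NormalForm (plug C₂ u) → Position C u

  classify : ∀ C {u} → IsQuasi (plug C u) → Position C u
  classify □ (nmQ a) = inLayer □L (nmN a) (nmQ a)
  classify □ (varQ x) = inLayer □L (varN x) (varQ x)
  classify □ (alienQ al nf) = underAlien □ □ refl □L al nf
  classify □ (fnQ f qs) = inLayer □L (fnN f _) (fnQ f qs)
  classify C@(conC _ _ _ _) (alienQ al nf) = underAlien □ C refl □L al nf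
  classify C@(fnC _ _ _ _ _) (alienQ al nf) = underAlien □ C refl □L al nf
  classify (fnC _ f k ts C) (fnQ _ qs) with classify C (All-at-update ts k qs)
  ... | inLayer L top q = inLayer (fnL f k ts L) top q
  ... | underAlien C₁ C₂ refl L al nf = underAlien (fnC i f k ts C₁) C₂ refl (fnL f k ts L) al nf

  quasi-replace : ∀ {C} → Layer C → ∀ {u w} → IsQuasi (plug C u) → IsQuasi w → IsQuasi (plug C w)
  quasi-replace □L q h = h
  quasi-replace (fnL f k ts L) (fnQ _ qs) h =
    fnQ f (All-update ts k qs (quasi-replace L (All-at-update ts k qs) h))
  quasi-replace (fnL f k ts L) (alienQ al _) h = ⊥-elim (fn-not-alien al)

  quasi-bin⁻ : ∀ f p x y → IsQuasi (bin i f p x y) → IsQuasi x × IsQuasi y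
  quasi-bin⁻ f p x y (fnQ _ qs) with All-subst⁻ (sym p) qs
  ... | qx ∷ qy ∷ [] = qx , qy
  quasi-bin⁻ f p x y (alienQ al _) = ⊥-elim (fn-not-alien al)

  quasi-bin : ∀ f p {x y} → IsQuasi x → IsQuasi y → IsQuasi (bin i f p x y)
  quasi-bin f p qx qy = fnQ f (All-subst (sym p) (qx ∷ qy ∷ []))

  mutual
    quasi-subst : ∀ {t} σ → IsPure t → (∀ x → var x ⊴ t → IsQuasi (σ x)) → IsQuasi (t ⟨ σ ⟩)
    quasi-subst σ (varP x) h = h x ⊴-refl
    quasi-subst σ (fnP f {ts} ps) h =
      fnQ f (quasi-subst* σ ps (λ k x o → h x (⊴-trans o (⊴-fn i f ts k))))

    quasi-subst* : ∀ {m} {ts : Vec Term m} σ → All IsPure ts →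
      (∀ k x → var x ⊴ lookup ts k → IsQuasi (σ x)) → All IsQuasi (ts ⟨ σ ⟩*)
    quasi-subst* σ [] h = []
    quasi-subst* σ (p ∷ ps) h = quasi-subst σ p (h zero) ∷ quasi-subst* σ ps (h ∘ suc)

  F-fn : ∀ f (ts : Vec Term (ar f)) → F (fn i f ts) ≡ fn i f (F* ts)
  F-fn f ts with i ≟ i
  ... | yes refl = refl
  ... | no ne = ⊥-elim (ne refl)

  F-alien : ∀ {t} → Alien i t → F t ≡ var (v t)
  F-alien (conA c ts) = refl
  F-alien (fnA j f ts ne) with j ≟ i
  ... | yes refl = ⊥-elim (ne refl)
  ... | no _ = refl

  F*-update : ∀ {m} (ts : Vec Term m) k x → F* (ts [ k ]≔ x) ≡ F* ts [ k ]≔ F x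
  F*-update (t ∷ ts) zero x = refl
  F*-update (t ∷ ts) (suc k) x = cong (F t ∷_) (F*-update ts k x)

  F-ctx : Ctx → Ctx
  F-ctx □ = □
  F-ctx (conC c k ts C) = conC c k (F* ts) (F-ctx C)
  F-ctx (fnC j f k ts C) = fnC j f k (F* ts) (F-ctx C)

  F-plug : ∀ {C} → Layer C → ∀ t → F (plug C t) ≡ plug (F-ctx C) (F t)
  F-plug □L t = refl
  F-plug (fnL f k ts {C} L) t = begin
    F (fn i f (ts [ k ]≔ plug C t))             ≡⟨ F-fn f _ ⟩
    fn i f (F* (ts [ k ]≔ plug C t))            ≡⟨ cong (fn i f) (F*-update ts k _) ⟩
    fn i f (F* ts [ k ]≔ F (plug C t))          ≡⟨ cong (λ x → fn i f (F* ts [ k ]≔ x)) (F-plug L t) ⟩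
    fn i f (F* ts [ k ]≔ plug (F-ctx C) (F t))  ∎
    where open ≡-Reasoning

  F*-transport : ∀ {a b} (q : a ≡ b) (xs : Vec Term a) →
    F* (subst (Vec Term) q xs) ≡ subst (Vec Term) q (F* xs)
  F*-transport refl xs = refl

  F-bin : ∀ f p x y → F (bin i f p x y) ≡ bin i f p (F x) (F y)
  F-bin f p x y = trans (F-fn f _) (cong (fn i f) (F*-transport (sym p) (x ∷ y ∷ [])))

  mutual
    F-subst : ∀ {t} → IsPure t → (σ : Var → Term) → F (t ⟨ σ ⟩) ≡ t ⟨ F ∘ σ ⟩
    F-subst (varP x) σ = refl
    F-subst (fnP f ps) σ = trans (F-fn f _) (cong (fn i f) (F*-subst ps σ))

    F*-subst : ∀ {m} {ts : Vec Term m} → All IsPure ts → (σ : Var → Term) →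
      F* (ts ⟨ σ ⟩*) ≡ ts ⟨ F ∘ σ ⟩*
    F*-subst [] σ = refl
    F*-subst (p ∷ ps) σ = cong₂ _∷_ (F-subst p σ) (F*-subst ps σ)

  -- An AC axiom instance whose head is not alien is one for the AC symbol of E_i: it
  -- relates quasi terms to quasi terms both ways, and F maps it to an instance of the
  -- same axiom.
  ACax-layer : ∀ {u w} → ACax u w → NonAlien u →
    (IsQuasi u → IsQuasi w) × (IsQuasi w → IsQuasi u) × ACax (F u) (F w)
  ACax-layer (comm {f = f} {p} x y e) (fnN _ _) =
    (λ q → let qx , qy = quasi-bin⁻ f p x y q in quasi-bin f p qy qx) ,
    (λ q → let qy , qx = quasi-bin⁻ f p y x q in quasi-bin f p qx qy) ,
    subst₂ ACax (sym (F-bin f p x y)) (sym (F-bin f p y x)) (comm (F x) (F y) e)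
  ACax-layer (assoc {f = f} {p} x y z e) (fnN _ _) =
    (λ q → let qxy , qz = quasi-bin⁻ f p _ z q ; qx , qy = quasi-bin⁻ f p x y qxy
           in quasi-bin f p qx (quasi-bin f p qy qz)) ,
    (λ q → let qx , qyz = quasi-bin⁻ f p x _ q ; qy , qz = quasi-bin⁻ f p y z qyz
           in quasi-bin f p (quasi-bin f p qx qy) qz) ,
    subst₂ ACax F-left F-right (assoc (F x) (F y) (F z) e)
    where
    F-left : bin i f p (bin i f p (F x) (F y)) (F z) ≡ F (bin i f p (bin i f p x y) z)
    F-left = sym (trans (F-bin f p _ z) (cong (λ a → bin i f p a (F z)) (F-bin f p x y)))
    F-right : bin i f p (F x) (bin i f p (F y) (F z)) ≡ F (bin i f p x (bin i f p y z))
    F-right = sym (trans (F-bin f p x _) (cong (bin i f p (F x)) (F-bin f p y z)))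

  ACax-nonalien⁻ : ∀ {u w} → ACax u w → NonAlien w → NonAlien u
  ACax-nonalien⁻ (comm x y e) (fnN _ _) = fnN _ _
  ACax-nonalien⁻ (assoc x y z e) (fnN _ _) = fnN _ _

  root-move-layer : ∀ {u w} → SymClosure ACax u w → NonAlien u → IsQuasi u →
    IsQuasi w × SymClosure ACax (F u) (F w)
  root-move-layer (fwd ax) top q =
    let to , _ , Fax = ACax-layer ax top in to q , fwd Fax
  root-move-layer (bwd ax) top q =
    let _ , from , Fax = ACax-layer ax (ACax-nonalien⁻ ax top) in from q , bwd Fax

  -- Replacing an alien normal form hanging off a layer by an AC-equal term keeps the
  -- term quasi and does not change its abstraction: both are E-equal ground terms,
  -- which v_E maps to the same variable.
  replace-alien : ∀ {C a a'} → Layer C → ACmove a a' → IsGround (plug C a) →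
    IsQuasi (plug C a) → Alien i a → NormalForm a →
    IsQuasi (plug C a') × F (plug C a) ≡ F (plug C a')
  replace-alien {C} {a} {a'} L m g q al nf =
    quasi-replace L q (alienQ al' (NF-=AC nf (m ◅ ε))) , (begin
      F (plug C a)                ≡⟨ F-plug L a ⟩
      plug (F-ctx C) (F a)        ≡⟨ cong (plug (F-ctx C)) (F-alien al) ⟩
      plug (F-ctx C) (var (v a))  ≡⟨ cong (plug (F-ctx C) ∘ var) same-variable ⟩
      plug (F-ctx C) (var (v a')) ≡⟨ cong (plug (F-ctx C)) (sym (F-alien al')) ⟩
      plug (F-ctx C) (F a')       ≡⟨ sym (F-plug L a') ⟩
      F (plug C a')               ∎)
    where
    open ≡-Reasoning
    al' : Alien i a'
    al' = ACmove-alien m al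
    ground-a : IsGround a
    ground-a = ground-plug⁻ C g
    same-variable : v a ≡ v a'
    same-variable = Equivalence.from
      (isv a a' (⇐ground ground-a) (⇐ground (ACmove-ground m ground-a))) (=AC⇒≈E (m ◅ ε))

  acRewrite : ∀ C {u w} → SymClosure ACax u w → IsGround (plug C u) → IsQuasi (plug C u) →
    IsQuasi (plug C w) × (F (plug C u) =AC F (plug C w))
  acRewrite C {u} {w} ax g q with classify C q
  ... | inLayer L top qu =
    let qw , Fax = root-move-layer ax top qu in
    quasi-replace L q qw ,
    subst₂ _=AC_ (sym (F-plug L u)) (sym (F-plug L w)) (ACmove-at (F-ctx C) Fax ◅ ε)
  ... | underAlien C₁ C₂ refl L al nf
    rewrite plug-· C₁ C₂ u | plug-· C₁ C₂ w =
    let qw , Feq = replace-alien L (ACmove-at C₂ ax) g q al nf in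
    qw , Star.reflexive ACmove Feq

  -- The left-hand side of a rule of E_j is a Σ_{E_j}-term and not a variable (by
  -- termination); so if an instance of it is not E_i-alien, the rule belongs to E_i.
  rule-theory : ∀ {j l r σ} → R j (l ⇒ r) → NonAlien (l ⟨ σ ⟩) → j ≡ i
  rule-theory {l = nm a} ρ (nmN a) = ⊥-elim (proj₁ (wfr _ _ ρ) _ ⊴-refl (nmF a))
  rule-theory {l = var x} ρ top = ⊥-elim (no-variable-lhs term ρ)
  rule-theory {l = con c ls} ρ ()
  rule-theory {j} {l = fn _ f ls} ρ (fnN _ _) with i ≟ j
  ... | yes e = sym e
  ... | no ne = ⊥-elim (proj₁ (wfr j _ ρ) _ ⊴-refl (alF (fnA i f ls ne)))

  -- A rule step at the hole of a layer uses a rule of E_i, keeps the term quasi (the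
  -- variables of the right-hand side are bound to quasi subterms of the redex), and F
  -- maps it to a step with the same rule.
  rule-in-layer : ∀ {j l r} (ρ : R j (l ⇒ r)) C σ → Layer C → NonAlien (l ⟨ σ ⟩) →
    IsQuasi (plug C (l ⟨ σ ⟩)) → IsQuasi (l ⟨ σ ⟩) →
    IsQuasi (plug C (r ⟨ σ ⟩)) × Rstep (F (plug C (l ⟨ σ ⟩))) (F (plug C (r ⟨ σ ⟩)))
  rule-in-layer {j} {l} {r} ρ C σ L top q ql with rule-theory ρ top
  ... | refl =
    quasi-replace L q (quasi-subst σ (pure⇒ r pure-r) quasi-σ) ,
    (i , (l ⇒ r) , ρ , F-ctx C , F ∘ σ , F-instance (pure⇒ l pure-l) , F-instance (pure⇒ r pure-r))
    where
    pure-l : Pure i l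
    pure-l = proj₁ (wfr i _ ρ)
    pure-r : Pure i r
    pure-r = proj₁ (proj₂ (wfr i _ ρ))
    quasi-σ : ∀ x → var x ⊴ r → IsQuasi (σ x)
    quasi-σ x o = IsQuasi-⊴ (var-⊴-subst σ (proj₂ (proj₂ (wfr i _ ρ)) x o)) ql
    F-instance : ∀ {t} → IsPure t → F (plug C (t ⟨ σ ⟩)) ≡ plug (F-ctx C) (t ⟨ F ∘ σ ⟩)
    F-instance {t} pt = trans (F-plug L (t ⟨ σ ⟩)) (cong (plug (F-ctx C)) (F-subst pt σ))

  -- A rule step from a quasi term: it cannot take place inside an alien normal form.
  rule-step : ∀ {s t} → Rstep s t → IsQuasi s → IsQuasi t × Rstep (F s) (F t)
  rule-step (j , (l ⇒ r) , ρ , C , σ , refl , refl) q with classify C q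
  ... | inLayer L top ql = rule-in-layer ρ C σ L top q ql
  ... | underAlien _ C₂ _ _ _ nf =
    ⊥-elim (nf (_ , Rstep⇒⟶ (Rstep-ctx C₂ (j , (l ⇒ r) , ρ , □ , σ , refl , refl))))

  Invariant : Term → Set
  Invariant t = IsGround t × IsQuasi t

  ac-move : ∀ {s t} → ACmove s t → Invariant s → Invariant t × (F s =AC F t)
  ac-move m@(fwd (C , u , w , ax , refl , refl)) (g , q) =
    let qw , Feq = acRewrite C (fwd ax) g q in (ACmove-ground m g , qw) , Feq
  ac-move m@(bwd (C , w , u , ax , refl , refl)) (g , q) =
    let qw , Feq = acRewrite C (bwd ax) g q in (ACmove-ground m g , qw) , Feq

  step : ∀ {s t} → s ⟶ t → Invariant s → Invariant t × (F s ⟶* F t)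
  step (s' , t' , p , st , p') inv =
    let (g₁ , q₁) , Fp = simulate* F ac-move p inv
        q₂ , Fst = rule-step st q₁
        inv₃ , Fp' = simulate* F ac-move p' (Rstep-ground wfr st g₁ , q₂)
    in inv₃ , (F s' , F t' , Fp , Fst , Fp') ◅ ε

proposition3p6 : (S : Sig) (R : Fin (Sig.n S) → Terms.Rule S → Set) →
    let open Terms S in
    let open Rewriting S R in
    Terminating → ConfluentModAC → WellFormedRules →
    (v : Term → Sig.Var S) → IsVE v →
    (i : Fin (Sig.n S)) (M N : Term) →
    Ground M → Quasi i M → M ⟶* N →
    Quasi i N × (Abstraction.F v i M ⟶* Abstraction.F v i N)
proposition3p6 S R term _ wfr v isv i M N ground-M quasi-M M⟶*N =
  let (_ , quasi-N) , FM⟶*FN = simulate* F step M⟶*N (ground⇒ M ground-M , quasi⇒ M quasi-M)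
  in quasi⇐ quasi-N , FM⟶*FN
  where
  open Rewriting.Abstraction S R v i using (F)
  open TermFacts S using (ground⇒)
  open Layers S R term wfr v isv i using (step; quasi⇒; quasi⇐)
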